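{- Let $G,H$ be finite simple connected graphs, $K\in\{G,H\}$ with $\bar K$ the other graph, and fix a root $(r_G,r_H)\in V(G\,\square\,H)$. Then every configuration $c$ on $G\,\square\,H$ that is unsolvable for this root (no sequence of pebbling moves from $c$ places a pebble on $(r_G,r_H)$) satisfies \[ \sum_{j\in V(\bar K)} set_{K,j}+1\ \le\ \pi(\bar K). \]
   Context: The Cartesian product $G\,\square\,H$ has vertex set $V(G)\times V(H)$, with $(g,h)\sim(g',h')$ iff ($g=g'$ and $h\sim_H h'$) or ($h=h'$ and $g\sim_G g'$). A configuration on a graph $X$ is a function $c:V(X)\to\mathbb{Z}_{\ge 0}$; its size is $\sum_v c(v)$. A pebbling move removes two pebbles from one vertex and adds one pebble to an adjacent vertex. The pebbling number $\pi(X)$ is the least $k$ such that from every configuration of size $k$ on $X$ and every root $r$ some sequence of pebbling moves places a pebble on $r$. For $K\in\{G,H\}$, $\bar K$ is the other graph. For $j\in V(\bar K)$ the $K$-slice $K_j$ is $\{(i,j):i\in V(G)\}$ if $K=G$, and $\{(j,h):h\in V(H)\}$ if $K=H$. For a configuration $c$, $\tilde c_{K,j}=\sum_{u\in K_j}c(u)$ and $set_{K,j}=\lfloor\tilde c_{K,j}/\pi(K)\rfloor$. -}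

module Defs where

open import Data.Nat using (ℕ; zero; suc; _+_; _∸_; _≤_)
open import Data.Nat.DivMod using (_/_)
open import Data.Bool using (if_then_else_)
open import Data.Fin using (Fin; _≟_)
open import Data.List using (map; allFin)
open import Data.Nat.ListAction using (sum)
open import Data.Product using (Σ; ∃; _×_; _,_)
open import Data.Product.Properties using (≡-dec)
open import Data.Sum using (_⊎_)
open import Relation.Nullary using (¬_; ⌊_⌋)
open import Relation.Binary.Definitions using (DecidableEquality)
open import Relation.Binary.PropositionalEquality using (_≡_)
open import Relation.Binary.Construct.Closure.ReflexiveTransitive using (Star)

record Graph : Set₁ where
  field
    n      : ℕ
    Adj    : Fin n → Fin n → Set
    sym    : ∀ {u v} → Adj u v → Adj v u
    irrefl : ∀ {u} → ¬ Adj u u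
open Graph public

Connected : Graph → Set
Connected G = ∀ u v → Star (Adj G) u v

Config : Set → Set
Config V = V → ℕ

move : {V : Set} → DecidableEquality V → Config V → V → V → Config V
move _≟V_ c u v w =
  (c w ∸ (if ⌊ w ≟V u ⌋ then 2 else 0)) + (if ⌊ w ≟V v ⌋ then 1 else 0)

data Step {V : Set} (dec : DecidableEquality V) (A : V → V → Set)
          (c : Config V) : Config V → Set where
  step : ∀ {u v} → A u v → 2 ≤ c u → Step dec A c (move dec c u v)

Solvable : {V : Set} → DecidableEquality V → (V → V → Set) → Config V → V → Set
Solvable dec A c r = ∃ λ c' → Star (Step dec A) c c' × 1 ≤ c' r

size : ∀ {n} → Config (Fin n) → ℕ
size {n} c = sum (map c (allFin n))

SolvesAllOfSize : Graph → ℕ → Set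
SolvesAllOfSize G k =
  ∀ (c : Config (Fin (n G))) (r : Fin (n G)) → size c ≡ k → Solvable _≟_ (Adj G) c r

IsPebblingNumber : Graph → ℕ → Set
IsPebblingNumber G k = SolvesAllOfSize G k × (∀ k' → SolvesAllOfSize G k' → k ≤ k')

□Vertex : Graph → Graph → Set
□Vertex G H = Fin (n G) × Fin (n H)

□dec : (G H : Graph) → DecidableEquality (□Vertex G H)
□dec G H = ≡-dec _≟_ _≟_

□Adj : (G H : Graph) → □Vertex G H → □Vertex G H → Set
□Adj G H (g , h) (g' , h') = (g ≡ g' × Adj H h h') ⊎ (h ≡ h' × Adj G g g')

-- floor division; the divisor 0 case never arises (π ≥ 1), returns 0 there.
floorDiv : ℕ → ℕ → ℕ
floorDiv x zero = 0
floorDiv x (suc p) = x / suc p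

c̃G : (G H : Graph) → Config (□Vertex G H) → Fin (n H) → ℕ
c̃G G H c j = sum (map (λ i → c (i , j)) (allFin (n G)))
c̃H : (G H : Graph) → Config (□Vertex G H) → Fin (n G) → ℕ
c̃H G H c j = sum (map (λ h → c (j , h)) (allFin (n H)))

sumSetG : (G H : Graph) → ℕ → Config (□Vertex G H) → ℕ
sumSetG G H pG c = sum (map (λ j → floorDiv (c̃G G H c j) pG) (allFin (n H)))
sumSetH : (G H : Graph) → ℕ → Config (□Vertex G H) → ℕ
sumSetH G H pH c = sum (map (λ j → floorDiv (c̃H G H c j) pH) (allFin (n G)))

-- In every slice K_j, π(K) pebbles suffice to move one pebble to (r_K, j), so by
-- repeating this set_{K,j} times (the unused pebbles just wait) the slice delivers
-- set_{K,j} pebbles to (r_K, j). Slices are disjoint, so this can be done in all of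
-- them, leaving Σ_j set_{K,j} pebbles on the K̄-slice through r_K. If that is at least
-- π(K̄), the root can be reached inside this K̄-slice, contradicting unsolvability.
module Submission where

open import Defs hiding (sym)
open import Data.Nat using (ℕ; zero; suc; _+_; _*_; _∸_; _⊓_; _≤_; z≤n)
open import Data.Nat.Properties
  using (≤-refl; ≤-trans; ≤-reflexive; +-comm; ⊓-comm; *-identityˡ; +-commutativeSemigroup;
         m≤m+n; +-mono-≤; +-monoˡ-≤; +-cancelˡ-≤; ∸-monoˡ-≤; +-∸-comm; m+n∸m≡n; m⊓n+n∸m≡n; ≰⇒>;
         module ≤-Reasoning)
open import Algebra.Properties.CommutativeSemigroup +-commutativeSemigroup using (interchange; xy∙z≈xz∙y)
open import Data.Nat.DivMod using (m/n*n≤m)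
open import Data.Bool using (if_then_else_)
open import Data.Fin using (Fin; zero; suc; _≟_)
open import Data.Vec.Functional using (head; tail) renaming (_∷_ to _◂_)
open import Data.List using (List; []; _∷_; allFin)
open import Data.List.Properties using (map-tabulate)
open import Data.Nat.ListAction using (sum)
open import Data.List.Membership.Propositional using (_∈_; _∉_)
open import Data.List.Membership.Propositional.Properties using (∈-allFin)
open import Data.List.Relation.Unary.Any using (here; there)
open import Data.List.Relation.Unary.All using () renaming (lookup to lookupAll)
open import Data.List.Relation.Unary.All.Properties using (All¬⇒¬Any)
open import Data.List.Relation.Unary.Unique.Propositional using (Unique)
open import Data.List.Relation.Unary.Unique.Propositional.Properties using (allFin⁺)
open import Data.List.Relation.Unary.AllPairs using ([]; _∷_)
open import Data.Product using (∃; _×_; _,_; proj₁; proj₂; swap)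
open import Data.Product.Properties using (,-injective)
open import Data.Sum using (inj₁; inj₂)
open import Function using (_∘_; id)
open import Relation.Nullary using (¬_; yes; no; ⌊_⌋; contradiction)
open import Relation.Binary.Definitions using (DecidableEquality)
open import Relation.Binary.PropositionalEquality
  using (_≡_; _≢_; ≢-sym; refl; sym; trans; cong; cong₂; subst; module ≡-Reasoning)
open import Relation.Binary.Construct.Closure.ReflexiveTransitive using (Star; ε; _◅_; _◅◅_)

size-suc : ∀ {m} (x : Config (Fin (suc m))) → size x ≡ head x + size (tail x)
size-suc x = cong (head x +_) (trans (cong sum (map-tabulate suc x))
                                     (sym (cong sum (map-tabulate id (tail x)))))

record Split {m} (x : Config (Fin m)) (k : ℕ) : Set where
  field
    part rest  : Config (Fin m)
    part+rest  : ∀ w → part w + rest w ≡ x w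
    size-part  : size part ≡ k
    size-rest  : k + size rest ≡ size x

split : ∀ {m} (x : Config (Fin m)) k → k ≤ size x → Split x k
split {zero} x zero z≤n = record
  { part = x ; rest = x ; part+rest = λ () ; size-part = refl ; size-rest = refl }
split {suc m} x k k≤x = record
  { part = k ⊓ x₀ ◂ part
  ; rest = x₀ ∸ k ◂ rest
  ; part+rest = λ { zero → m⊓n+n∸m≡n k x₀ ; (suc w) → part+rest w }
  ; size-part = size-part′
  ; size-rest = size-rest′
  }
  where
  open ≡-Reasoning
  x₀ : ℕ
  x₀ = head x

  k∸x₀≤tail : k ∸ x₀ ≤ size (tail x)
  k∸x₀≤tail = subst (k ∸ x₀ ≤_) (m+n∸m≡n x₀ (size (tail x)))
                    (∸-monoˡ-≤ x₀ (subst (k ≤_) (size-suc x) k≤x))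

  open Split (split (tail x) (k ∸ x₀) k∸x₀≤tail)

  k⊓x₀+k∸x₀≡k : k ⊓ x₀ + (k ∸ x₀) ≡ k
  k⊓x₀+k∸x₀≡k = trans (cong (_+ (k ∸ x₀)) (⊓-comm k x₀)) (m⊓n+n∸m≡n x₀ k)

  size-part′ : size (k ⊓ x₀ ◂ part) ≡ k
  size-part′ = trans (size-suc (k ⊓ x₀ ◂ part))
                     (trans (cong (k ⊓ x₀ +_) size-part) k⊓x₀+k∸x₀≡k)

  size-rest′ : k + size (x₀ ∸ k ◂ rest) ≡ size x
  size-rest′ = begin
    k + size (x₀ ∸ k ◂ rest)                    ≡⟨ cong (k +_) (size-suc (x₀ ∸ k ◂ rest)) ⟩
    k + (x₀ ∸ k + size rest)                    ≡⟨ cong (_+ (x₀ ∸ k + size rest)) (sym k⊓x₀+k∸x₀≡k) ⟩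
    (k ⊓ x₀ + (k ∸ x₀)) + (x₀ ∸ k + size rest)  ≡⟨ interchange (k ⊓ x₀) (k ∸ x₀) (x₀ ∸ k) (size rest) ⟩
    (k ⊓ x₀ + (x₀ ∸ k)) + (k ∸ x₀ + size rest)  ≡⟨ cong₂ _+_ (m⊓n+n∸m≡n k x₀) size-rest ⟩
    x₀ + size (tail x)                          ≡⟨ sym (size-suc x) ⟩
    size x                                      ∎

-- At a single vertex a move turns a pebbles into a ∸ l + g,
-- with l ∈ {0, 2} lost and g ∈ {0, 1} gained.
move-frame : ∀ {a b e} l g → l ≤ a → a + e ≤ b → a ∸ l + g + e ≤ b ∸ l + g
move-frame {a} {b} {e} l g l≤a a+e≤b = begin
  a ∸ l + g + e   ≡⟨ xy∙z≈xz∙y (a ∸ l) g e ⟩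
  a ∸ l + e + g   ≡⟨ cong (_+ g) (sym (+-∸-comm e l≤a)) ⟩
  a + e ∸ l + g   ≤⟨ +-monoˡ-≤ g (∸-monoˡ-≤ l a+e≤b) ⟩
  b ∸ l + g       ∎
  where open ≤-Reasoning

module Pebbling {V : Set} (_≟V_ : DecidableEquality V) (A : V → V → Set) where

  infix 4 _⇒*_
  _⇒*_ : Config V → Config V → Set
  _⇒*_ = Star (Step _≟V_ A)

  move-off-source : ∀ c {u v w} → w ≢ u → c w ≤ move _≟V_ c u v w
  move-off-source c {u} {w = w} w≢u with w ≟V u
  ... | yes w≡u = contradiction w≡u w≢u
  ... | no _    = m≤m+n (c w) _

  move-mono : ∀ {c c'} u v w → c w ≤ c' w → move _≟V_ c u v w ≤ move _≟V_ c' u v w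
  move-mono u v w = +-monoˡ-≤ (if ⌊ w ≟V v ⌋ then 1 else 0) ∘ ∸-monoˡ-≤ (if ⌊ w ≟V u ⌋ then 2 else 0)

  ⇒*-frame : ∀ {d d'} → d ⇒* d' → (e f : Config V) → (∀ w → d w + e w ≤ f w) →
             ∃ λ f' → f ⇒* f' × (∀ w → d' w + e w ≤ f' w)
  ⇒*-frame ε e f d+e≤f = f , ε , d+e≤f
  ⇒*-frame {d} (step {u} {v} uv 2≤du ◅ moves) e f d+e≤f
    with ⇒*-frame moves e (move _≟V_ f u v) after-move
    where
    after-move : ∀ w → move _≟V_ d u v w + e w ≤ move _≟V_ f u v w
    after-move w with w ≟V u
    ... | yes refl = move-frame 2 _ 2≤du (d+e≤f w)
    ... | no _     = move-frame {d w} 0 _ z≤n (d+e≤f w)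
  ... | f' , moves' , d'+e≤f' =
    f' , step uv (≤-trans 2≤du (≤-trans (m≤m+n (d u) (e u)) (d+e≤f u))) ◅ moves' , d'+e≤f'

  ⇒*-parallel : ∀ {d d' e e'} → d ⇒* d' → e ⇒* e' →
                (f : Config V) → (∀ w → d w + e w ≤ f w) →
                ∃ λ f' → f ⇒* f' × (∀ w → d' w + e' w ≤ f' w)
  ⇒*-parallel {d} {d'} {e} {e'} d⇒*d' e⇒*e' f d+e≤f
    with ⇒*-frame d⇒*d' e f d+e≤f
  ... | f₁ , moves₁ , d'+e≤f₁
    with ⇒*-frame e⇒*e' d' f₁ (λ w → subst (_≤ f₁ w) (+-comm (d' w) (e w)) (d'+e≤f₁ w))
  ... | f₂ , moves₂ , e'+d'≤f₂ =
    f₂ , moves₁ ◅◅ moves₂ , λ w → subst (_≤ f₂ w) (+-comm (e' w) (d' w)) (e'+d'≤f₂ w)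

module Embedding {W V : Set} (_≟W_ : DecidableEquality W) (B : W → W → Set)
                 (_≟V_ : DecidableEquality V) (A : V → V → Set)
                 (φ : W → V) (φ-injective : ∀ {i j} → φ i ≡ φ j → i ≡ j)
                 (φ-adj : ∀ {i j} → B i j → A (φ i) (φ j)) where

  open Pebbling _≟W_ B using (move-mono) renaming (_⇒*_ to _⇒ᵂ*_)
  open Pebbling _≟V_ A using (move-off-source) renaming (_⇒*_ to _⇒ⱽ*_)

  ≟-φ : ∀ i j → ⌊ i ≟W j ⌋ ≡ ⌊ φ i ≟V φ j ⌋
  ≟-φ i j with i ≟W j | φ i ≟V φ j
  ... | yes _    | yes _     = refl
  ... | no _     | no _      = refl
  ... | yes refl | no φi≢φi  = contradiction refl φi≢φi
  ... | no i≢j   | yes φi≡φj = contradiction (φ-injective φi≡φj) i≢j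

  move-φ : ∀ (c : Config V) u w i → move _≟W_ (c ∘ φ) u w i ≡ move _≟V_ c (φ u) (φ w) (φ i)
  move-φ c u w i rewrite ≟-φ i u | ≟-φ i w = refl

  lift-⇒* : ∀ {x x'} → x ⇒ᵂ* x' → (c : Config V) → (∀ i → x i ≤ c (φ i)) →
            ∃ λ c' → c ⇒ⱽ* c' × (∀ i → x' i ≤ c' (φ i)) × (∀ v → (∀ i → v ≢ φ i) → c v ≤ c' v)
  lift-⇒* ε c x≤c = c , ε , x≤c , λ _ _ → ≤-refl
  lift-⇒* {x} (step {u} {w} uw 2≤xu ◅ moves) c x≤c
    with lift-⇒* moves (move _≟V_ c (φ u) (φ w)) after-move
    where
    after-move : ∀ i → move _≟W_ x u w i ≤ move _≟V_ c (φ u) (φ w) (φ i)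
    after-move i = subst (move _≟W_ x u w i ≤_) (move-φ c u w i)
                         (move-mono {x} {c ∘ φ} u w i (x≤c i))
  ... | c' , moves' , x'≤c' , off-image =
    c' , step (φ-adj uw) (≤-trans 2≤xu (x≤c u)) ◅ moves' , x'≤c' ,
    λ v v∉φ → ≤-trans (move-off-source c (v∉φ u)) (off-image v v∉φ)

floorDiv*n≤m : ∀ m n → floorDiv m n * n ≤ m
floorDiv*n≤m m zero    = z≤n
floorDiv*n≤m m (suc n) = m/n*n≤m m (suc n)

module PebblingNumber (K : Graph) (π : ℕ) (solves : SolvesAllOfSize K π) where

  open Pebbling {Fin (n K)} _≟_ (Adj K)

  stack-on-root : ∀ k (x : Config (Fin (n K))) r → k * π ≤ size x → ∃ λ x' → x ⇒* x' × k ≤ x' r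
  stack-on-root zero    x r _ = x , ε , z≤n
  stack-on-root (suc k) x r [1+k]π≤x =
    combine (solves part r size-part) (stack-on-root k rest r kπ≤rest)
    where
    open Split (split x π (≤-trans (m≤m+n π (k * π)) [1+k]π≤x))

    kπ≤rest : k * π ≤ size rest
    kπ≤rest = +-cancelˡ-≤ π _ _ (subst (π + k * π ≤_) (sym size-rest) [1+k]π≤x)

    combine : Solvable _≟_ (Adj K) part r → (∃ λ z → rest ⇒* z × k ≤ z r) →
              ∃ λ x' → x ⇒* x' × suc k ≤ x' r
    combine (y , part⇒*y , 1≤y) (z , rest⇒*z , k≤z)
      with ⇒*-parallel part⇒*y rest⇒*z x (λ w → ≤-reflexive (part+rest w))
    ... | x' , x⇒*x' , y+z≤x' = x' , x⇒*x' , ≤-trans (+-mono-≤ 1≤y k≤z) (y+z≤x' r)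

-- ι i j is the vertex of the slice K_j indexed by i ∈ V(K); in G □ H it is (i , j) for K = G
-- and (j , i) for K = H.
module Slices {V : Set} (_≟V_ : DecidableEquality V) (A : V → V → Set) (K L : Graph)
              (ι : Fin (n K) → Fin (n L) → V)
              (ι-injective : ∀ {i i' j j'} → ι i j ≡ ι i' j' → i ≡ i' × j ≡ j')
              (ι-adjᴷ : ∀ {i i' j} → Adj K i i' → A (ι i j) (ι i' j))
              (ι-adjᴸ : ∀ {i j j'} → Adj L j j' → A (ι i j) (ι i j'))
              (πK πL : ℕ) (solvesK : SolvesAllOfSize K πK) (solvesL : SolvesAllOfSize L πL)
              (rK : Fin (n K)) (rL : Fin (n L)) (c₀ : Config V) where

  open Pebbling _≟V_ A using (_⇒*_)
  open PebblingNumber K πK solvesK using () renaming (stack-on-root to stack-on-rootᴷ)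
  open PebblingNumber L πL solvesL using () renaming (stack-on-root to stack-on-rootᴸ)

  module Slice (j : Fin (n L)) =
    Embedding _≟_ (Adj K) _≟V_ A (λ i → ι i j) (proj₁ ∘ ι-injective) ι-adjᴷ
  module RootSlice = Embedding _≟_ (Adj L) _≟V_ A (ι rK) (proj₂ ∘ ι-injective) ι-adjᴸ

  slice : Config V → Fin (n L) → Config (Fin (n K))
  slice c j i = c (ι i j)

  set : Fin (n L) → ℕ
  set j = floorDiv (size (slice c₀ j)) πK

  gather-slice : ∀ j c → (∀ i → slice c₀ j i ≤ slice c j i) →
                 ∃ λ c' → c ⇒* c' × set j ≤ c' (ι rK j) ×
                   (∀ {j'} → j' ≢ j → ∀ i → slice c j' i ≤ slice c' j' i)
  gather-slice j c c₀≤c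
    with stack-on-rootᴷ (set j) (slice c₀ j) rK (floorDiv*n≤m (size (slice c₀ j)) πK)
  ... | x , moves , set≤x
    with Slice.lift-⇒* j moves c c₀≤c
  ... | c' , moves' , x≤c' , off-slice =
    c' , moves' , ≤-trans set≤x (x≤c' rK) ,
    λ {j'} j'≢j i → off-slice (ι i j') (λ _ eq → j'≢j (proj₂ (ι-injective eq)))

  gather-slices : (js : List (Fin (n L))) → Unique js →
                  ∀ c → (∀ {j} → j ∈ js → ∀ i → slice c₀ j i ≤ slice c j i) →
                  ∃ λ c' → c ⇒* c' × (∀ {j} → j ∈ js → set j ≤ c' (ι rK j)) ×
                    (∀ {j} → j ∉ js → ∀ i → slice c j i ≤ slice c' j i)
  gather-slices [] _ c _ = c , ε , (λ ()) , λ _ _ → ≤-refl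
  gather-slices (j ∷ js) (j≢js ∷ unique) c c₀≤c
    with gather-slice j c (c₀≤c (here refl))
  ... | c₁ , moves₁ , set≤c₁ , kept₁
    with gather-slices js unique c₁ c₀≤c₁
    where
    c₀≤c₁ : ∀ {j'} → j' ∈ js → ∀ i → slice c₀ j' i ≤ slice c₁ j' i
    c₀≤c₁ j'∈js i = ≤-trans (c₀≤c (there j'∈js) i) (kept₁ (≢-sym (lookupAll j≢js j'∈js)) i)
  ... | c₂ , moves₂ , set≤c₂ , kept₂ = c₂ , moves₁ ◅◅ moves₂ , set≤ , kept
    where
    set≤ : ∀ {j'} → j' ∈ j ∷ js → set j' ≤ c₂ (ι rK j')
    set≤ (here refl)   = ≤-trans set≤c₁ (kept₂ (All¬⇒¬Any j≢js) rK)
    set≤ (there j'∈js) = set≤c₂ j'∈js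

    kept : ∀ {j'} → j' ∉ j ∷ js → ∀ i → slice c j' i ≤ slice c₂ j' i
    kept j'∉ i = ≤-trans (kept₁ (j'∉ ∘ here) i) (kept₂ (j'∉ ∘ there) i)

  solvable-if-π≤Σset : πL ≤ size set → Solvable _≟V_ A c₀ (ι rK rL)
  solvable-if-π≤Σset πL≤Σset
    with gather-slices (allFin (n L)) (allFin⁺ (n L)) c₀ (λ _ _ → ≤-refl)
  ... | c₁ , moves₁ , set≤c₁ , _
    with stack-on-rootᴸ 1 set rL (subst (_≤ size set) (sym (*-identityˡ πL)) πL≤Σset)
  ... | y , moves , 1≤y
    with RootSlice.lift-⇒* moves c₁ (λ j → set≤c₁ (∈-allFin j))
  ... | c₂ , moves₂ , y≤c₂ , _ = c₂ , moves₁ ◅◅ moves₂ , ≤-trans 1≤y (y≤c₂ rL)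

  Σset<π : ¬ Solvable _≟V_ A c₀ (ι rK rL) → size set + 1 ≤ πL
  Σset<π unsolvable =
    subst (_≤ πL) (+-comm 1 (size set)) (≰⇒> (unsolvable ∘ solvable-if-π≤Σset))

theorem1 : (G H : Graph) → Connected G → Connected H →
    (pG pH : ℕ) → IsPebblingNumber G pG → IsPebblingNumber H pH →
    (rG : Fin (n G)) (rH : Fin (n H)) (c : Config (□Vertex G H)) →
    ¬ Solvable (□dec G H) (□Adj G H) c (rG , rH) →
    (sumSetG G H pG c + 1 ≤ pH) × (sumSetH G H pH c + 1 ≤ pG)
theorem1 G H _ _ pG pH (solvesG , _) (solvesH , _) rG rH c unsolvable =
  Slices.Σset<π (□dec G H) (□Adj G H) G H (λ g h → g , h) ,-injective
                (λ gg' → inj₂ (refl , gg')) (λ hh' → inj₁ (refl , hh'))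
                pG pH solvesG solvesH rG rH c unsolvable ,
  Slices.Σset<π (□dec G H) (□Adj G H) H G (λ h g → g , h) (swap ∘ ,-injective)
                (λ hh' → inj₁ (refl , hh')) (λ gg' → inj₂ (refl , gg'))
                pH pG solvesH solvesG rH rG c unsolvable
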